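{- Let $\mathcal{M}$ be a $k$-orbit $(n-1)$-maniplex and let $T(\mathcal{M})$ be its symmetry type graph. Suppose $T(\mathcal{M})$ has a Hamiltonian path $v_1,e_1,v_2,e_2,\dots,e_{k-1},v_k$, where $e_m$ is an edge of colour $a_m$ joining $v_m$ and $v_{m+1}$. For each $i\in\{1,\dots,k\}$ let $S_i\subseteq\{0,\dots,n-1\}$ be the set of colours $s$ such that $v_i$ carries a semi-edge of colour $s$. For $1\le i<j\le k$ let $B_{i,j}$ be the set of colours of the edges joining $v_i$ and $v_j$ that are not edges of the path. Let $\Phi$ be a flag of $\mathcal{M}$ lying in the orbit $v_1$. Then $\mathrm{Aut}(\mathcal{M})$ is generated by the union of $$\{\alpha_{a_1,\dots,a_{i-1},s,a_{i-1},\dots,a_1}\mid 1\le i\le k,\ s\in S_i\}$$ and $$\{\alpha_{a_1,\dots,a_{i-1},b,a_{j-1},\dots,a_1}\mid 1\le i<j\le k,\ b\in B_{i,j}\}$$ (where for $i=1$ the index sequence $a_1,\dots,a_{i-1}$ is empty).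
   Context: An $(n-1)$-maniplex is given by a connected simple graph (flag graph), whose vertices are called flags, with a proper edge-colouring by colours $\{0,\dots,n-1\}$, each colour class a perfect matching, such that for colours $i,j$ with $|i-j|\ge2$ each component of the subgraph spanned by colours $i,j$ is a 4-cycle. $\Phi^i$ denotes the flag $i$-adjacent to $\Phi$, and $\Phi^{c_1,c_2,\dots,c_m}=(\cdots((\Phi^{c_1})^{c_2})\cdots)^{c_m}$. Automorphisms are colour-preserving graph automorphisms; $k$-orbit means $\mathrm{Aut}(\mathcal{M})$ has exactly $k$ orbits on flags, and $\mathrm{Aut}(\mathcal{M})$ acts freely on flags. For a fixed base flag $\Phi$ and a colour sequence $c_1,\dots,c_m$ such that $\Phi^{c_1,\dots,c_m}$ lies in the $\mathrm{Aut}(\mathcal{M})$-orbit of $\Phi$, $\alpha_{c_1,\dots,c_m}$ denotes the unique automorphism mapping $\Phi$ to $\Phi^{c_1,\dots,c_m}$. The symmetry type graph $T(\mathcal{M})$ is the pregraph whose vertices are the flag orbits, with an edge of colour $c$ between distinct orbits $B,C$ iff some flag of $B$ is $c$-adjacent to a flag of $C$, and a semi-edge of colour $c$ at $B$ iff some flag of $B$ is $c$-adjacent to a flag of $B$; each vertex carries exactly one edge or semi-edge of each colour. -}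

module Defs where

open import Data.Nat using (ℕ; zero; suc; _≤_; ∣_-_∣)
open import Data.Fin using (Fin; zero; suc; toℕ; inject₁) renaming (_<_ to _<ᶠ_)
open import Data.List using (List; []; _∷_; _++_; reverse)
open import Data.Product using (Σ; ∃; ∃-syntax; _×_; _,_)
open import Data.Sum using (_⊎_)
open import Relation.Binary.PropositionalEquality using (_≡_; _≢_)
open import Relation.Nullary using (¬_)
open import Function using (_∘_; _⇔_)

walk : ∀ {n} {X : Set} → (Fin n → X → X) → X → List (Fin n) → X
walk adj Φ []       = Φ
walk adj Φ (c ∷ w) = walk adj (adj c Φ) w

-- An (n-1)-maniplex, given by its flag graph: flags, and for each colour i
-- the perfect matching Φ ↦ Φ^i.
record Maniplex (n : ℕ) : Set₁ where
  field
    Flag      : Set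
    adj       : Fin n → Flag → Flag
    adj-invol : ∀ i Φ → adj i (adj i Φ) ≡ Φ
    adj-loopfree : ∀ i Φ → adj i Φ ≢ Φ
    simple    : ∀ i j Φ → i ≢ j → adj i Φ ≢ adj j Φ
    -- for |i - j| ≥ 2 every (i,j)-component is a 4-cycle
    -- (given the above, equivalent to Φ^{i,j,i,j} = Φ)
    four-cycle : ∀ i j Φ → 2 ≤ ∣ toℕ i - toℕ j ∣ →
                 adj j (adj i (adj j (adj i Φ))) ≡ Φ
    connected : ∀ Φ Ψ → ∃[ w ] walk adj Φ w ≡ Ψ

open Maniplex public

record Aut {n} (M : Maniplex n) : Set where
  field
    fun   : Flag M → Flag M
    inv   : Flag M → Flag M
    inv-fun : ∀ Φ → inv (fun Φ) ≡ Φ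
    fun-inv : ∀ Φ → fun (inv Φ) ≡ Φ
    hom   : ∀ i Φ → fun (adj M i Φ) ≡ adj M i (fun Φ)

open Aut public

idAut : ∀ {n} {M : Maniplex n} → Aut M
idAut = record { fun = λ x → x ; inv = λ x → x
               ; inv-fun = λ _ → _≡_.refl ; fun-inv = λ _ → _≡_.refl
               ; hom = λ _ _ → _≡_.refl }

module _ {n} {M : Maniplex n} where
  open import Relation.Binary.PropositionalEquality using (cong; trans; sym)

  _∘ᴬ_ : Aut M → Aut M → Aut M
  σ ∘ᴬ τ = record
    { fun = fun σ ∘ fun τ
    ; inv = inv τ ∘ inv σ
    ; inv-fun = λ Φ → trans (cong (inv τ) (inv-fun σ (fun τ Φ))) (inv-fun τ Φ)
    ; fun-inv = λ Φ → trans (cong (fun σ) (fun-inv τ (inv σ Φ))) (fun-inv σ Φ)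
    ; hom = λ i Φ → trans (cong (fun σ) (hom τ i Φ)) (hom σ i (fun τ Φ)) }

  _⁻¹ᴬ : Aut M → Aut M
  σ ⁻¹ᴬ = record
    { fun = inv σ ; inv = fun σ ; inv-fun = fun-inv σ ; fun-inv = inv-fun σ
    ; hom = λ i Φ → trans (cong (λ x → inv σ (adj M i x)) (sym (fun-inv σ Φ)))
                   (trans (cong (inv σ) (sym (hom σ i (inv σ Φ))))
                          (inv-fun σ (adj M i (inv σ Φ)))) }

-- the subgroup of Aut(M) generated by a set X of automorphisms
-- (automorphisms are compared extensionally, i.e. as maps on flags)
data ⟨_⟩ {n} {M : Maniplex n} (X : Aut M → Set) : Aut M → Set where
  gen  : ∀ {σ} → X σ → ⟨ X ⟩ σ
  one  : ⟨ X ⟩ idAut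
  mul  : ∀ {σ τ} → ⟨ X ⟩ σ → ⟨ X ⟩ τ → ⟨ X ⟩ (σ ∘ᴬ τ)
  invs : ∀ {σ} → ⟨ X ⟩ σ → ⟨ X ⟩ (σ ⁻¹ᴬ)
  ext  : ∀ {σ τ} → (∀ Φ → fun σ Φ ≡ fun τ Φ) → ⟨ X ⟩ σ → ⟨ X ⟩ τ

-- M is a k-orbit maniplex, with `orb` labelling the Aut(M)-orbits on flags
-- by Fin k: orb is onto and two flags get the same label iff they lie in the
-- same Aut(M)-orbit.
IsOrbitMap : ∀ {n k} (M : Maniplex n) → (Flag M → Fin k) → Set
IsOrbitMap M orb =
  (∀ B → ∃[ Φ ] orb Φ ≡ B) ×
  (∀ Φ Ψ → (orb Φ ≡ orb Ψ) ⇔ (Σ (Aut M) λ σ → fun σ Φ ≡ Ψ))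

-- Symmetry type graph T(M) (vertices = orbit labels Fin k)
-- semi-edge of colour c at B
TSemi : ∀ {n k} (M : Maniplex n) → (Flag M → Fin k) → Fin n → Fin k → Set
TSemi M orb c B = ∃[ Φ ] (orb Φ ≡ B × orb (adj M c Φ) ≡ B)

TEdge : ∀ {n k} (M : Maniplex n) → (Flag M → Fin k) → Fin n → Fin k → Fin k → Set
TEdge M orb c B C = B ≢ C × ∃[ Φ ] (orb Φ ≡ B × orb (adj M c Φ) ≡ C)

-- Path data (0-indexed): vertices v 0,…,v k', edges of colour a m joining
-- v m and v (m+1).  prefix a i = a₀,…,a_{i-1}.
prefix : ∀ {n k} → (Fin k → Fin n) → Fin (suc k) → List (Fin n)
prefix a zero = []
prefix {k = suc k} a (suc i) = a zero ∷ prefix (a ∘ suc) i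

PathEdge : ∀ {n k} → (Fin k → Fin n) → Fin (suc k) → Fin (suc k) → Fin n → Set
PathEdge a i j b = ∃[ m ] (inject₁ m ≡ i × suc m ≡ j × a m ≡ b)

-- The generating set of Theorem 5.2, as a predicate on Aut(M):
-- σ = α_w means σ maps the base flag Φ to Φ^w (unique since the action is free).
GenSet : ∀ {n k} (M : Maniplex n) (orb : Flag M → Fin (suc k))
         (v : Fin (suc k) → Fin (suc k)) (a : Fin k → Fin n) (Φ : Flag M) →
         Aut M → Set
GenSet M orb v a Φ σ =
  (Σ (Fin _) λ i → Σ (Fin _) λ s →
      TSemi M orb s (v i) ×
      fun σ Φ ≡ walk (adj M) Φ (prefix a i ++ s ∷ reverse (prefix a i)))
  ⊎
  (Σ (Fin _) λ i → Σ (Fin _) λ j → Σ (Fin _) λ b →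
      i <ᶠ j × TEdge M orb b (v i) (v j) × ¬ PathEdge a i j b ×
      fun σ Φ ≡ walk (adj M) Φ (prefix a i ++ b ∷ reverse (prefix a j)))

-- The flags P i = Φ^{a₀,…,a_{i-1}} form a transversal of the flag orbits, P i lying in v i.
-- Call ρ a connecting automorphism if ρ(P j) = (P i)^c for some colour c.  Such a ρ is a
-- semi-edge generator (i = j), an edge generator (i < j, c not a path colour), the identity
-- (i < j and c the path colour a_i, since then (P i)^c = P j and the action is free), or the
-- inverse of one of these (i > j).  For any σ, walk from Φ to σΦ: if τ carries the
-- representative of Ψ's orbit to Ψ, and τ' carries a representative to Ψ^c, then τ⁻¹τ' is
-- connecting, so by induction along the walk σ is a product of connecting automorphisms.
module Submission where

open import Defs
open import Data.Nat using (suc)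
open import Data.Fin using (Fin; zero; suc; inject₁; _≟_) renaming (_<_ to _<ᶠ_)
open import Data.Fin.Properties using (any?; <-cmp; <⇒≢)
open import Data.List using ([]; _∷_; [_]; _++_; reverse)
open import Data.List.Properties using (unfold-reverse)
open import Data.Product using (Σ; _×_; _,_; proj₂)
open import Data.Sum using (inj₁; inj₂)
open import Relation.Binary.PropositionalEquality
  using (_≡_; refl; sym; trans; cong; module ≡-Reasoning)
open import Relation.Binary.Definitions using (tri<; tri≈; tri>)
open import Relation.Nullary using (¬_; Dec; yes; no)
open import Relation.Nullary.Decidable using (_×-dec_)
open import Function using (_∘_; Equivalence)
open import Function.Definitions using (Injective; Surjective)

open ≡-Reasoning

module _ {n} {X : Set} (adj′ : Fin n → X → X) where

  walk-++ : ∀ x us ws → walk adj′ x (us ++ ws) ≡ walk adj′ (walk adj′ x us) ws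
  walk-++ x []       ws = refl
  walk-++ x (u ∷ us) ws = walk-++ (adj′ u x) us ws

  walk-reverse-cancel : (∀ c x → adj′ c (adj′ c x) ≡ x) →
                        ∀ x ws → walk adj′ (walk adj′ x ws) (reverse ws) ≡ x
  walk-reverse-cancel invol x []       = refl
  walk-reverse-cancel invol x (w ∷ ws) = begin
    walk adj′ y (reverse (w ∷ ws))   ≡⟨ cong (walk adj′ y) (unfold-reverse w ws) ⟩
    walk adj′ y (reverse ws ++ [ w ]) ≡⟨ walk-++ y (reverse ws) [ w ] ⟩
    adj′ w (walk adj′ y (reverse ws)) ≡⟨ cong (adj′ w) (walk-reverse-cancel invol (adj′ w x) ws) ⟩
    adj′ w (adj′ w x)                 ≡⟨ invol w x ⟩
    x                                 ∎
    where
      y : X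
      y = walk adj′ (adj′ w x) ws

prefix-suc : ∀ {n k} (a : Fin k → Fin n) (m : Fin k) →
             prefix a (suc m) ≡ prefix a (inject₁ m) ++ [ a m ]
prefix-suc a zero    = refl
prefix-suc a (suc m) = cong (a zero ∷_) (prefix-suc (a ∘ suc) m)

PathEdge? : ∀ {n k} (a : Fin k → Fin n) i j c → Dec (PathEdge a i j c)
PathEdge? a i j c = any? (λ m → (inject₁ m ≟ i) ×-dec ((suc m ≟ j) ×-dec (a m ≟ c)))

module _ {n} (M : Maniplex n) where

  fun-walk : ∀ (σ : Aut M) Ψ w → fun σ (walk (adj M) Ψ w) ≡ walk (adj M) (fun σ Ψ) w
  fun-walk σ Ψ []      = refl
  fun-walk σ Ψ (c ∷ w) = trans (fun-walk σ (adj M c Ψ) w) (cong (λ x → walk (adj M) x w) (hom σ c Ψ))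

  fixes-flag⇒fixes-all : ∀ (σ : Aut M) Ψ → fun σ Ψ ≡ Ψ → ∀ Ψ′ → fun σ Ψ′ ≡ Ψ′
  fixes-flag⇒fixes-all σ Ψ σΨ≡Ψ Ψ′ with connected M Ψ Ψ′
  ... | w , refl = trans (fun-walk σ Ψ w) (cong (λ x → walk (adj M) x w) σΨ≡Ψ)

  fixes-flag⇒generated : ∀ {X} (σ : Aut M) Ψ → fun σ Ψ ≡ Ψ → ⟨ X ⟩ σ
  fixes-flag⇒generated σ Ψ σΨ≡Ψ = ext (λ Ψ′ → sym (fixes-flag⇒fixes-all σ Ψ σΨ≡Ψ Ψ′)) one

  inv-adj : ∀ (τ : Aut M) c {Ψ Ψ′} → fun τ Ψ ≡ Ψ′ → inv τ (adj M c Ψ′) ≡ adj M c Ψ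
  inv-adj τ c {Ψ} {Ψ′} τΨ≡Ψ′ = begin
    inv τ (adj M c Ψ′)         ≡⟨ cong (inv τ ∘ adj M c) (sym τΨ≡Ψ′) ⟩
    inv τ (adj M c (fun τ Ψ))  ≡⟨ cong (inv τ) (sym (hom τ c Ψ)) ⟩
    inv τ (fun τ (adj M c Ψ))  ≡⟨ inv-fun τ _ ⟩
    adj M c Ψ                  ∎

  inv-connecting : ∀ (ρ : Aut M) c {Ψ Ψ′} → fun ρ Ψ′ ≡ adj M c Ψ → inv ρ Ψ ≡ adj M c Ψ′
  inv-connecting ρ c {Ψ} ρΨ′≡Ψᶜ =
    trans (cong (inv ρ) (sym (adj-invol M c Ψ))) (inv-adj ρ c ρΨ′≡Ψᶜ)

  fun≡walk-word : ∀ (ρ : Aut M) Φ u c w →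
    fun ρ (walk (adj M) Φ w) ≡ adj M c (walk (adj M) Φ u) →
    fun ρ Φ ≡ walk (adj M) Φ (u ++ c ∷ reverse w)
  fun≡walk-word ρ Φ u c w ρΦʷ≡Φᵘᶜ = begin
    fun ρ Φ                                       ≡⟨ cong (fun ρ) (sym (walk-reverse-cancel (adj M) (adj-invol M) Φ w)) ⟩
    fun ρ (walk (adj M) Φʷ (reverse w))            ≡⟨ fun-walk ρ Φʷ (reverse w) ⟩
    walk (adj M) (fun ρ Φʷ) (reverse w)            ≡⟨ cong (λ x → walk (adj M) x (reverse w)) ρΦʷ≡Φᵘᶜ ⟩
    walk (adj M) (adj M c (walk (adj M) Φ u)) (reverse w) ≡⟨ sym (walk-++ (adj M) Φ u (c ∷ reverse w)) ⟩
    walk (adj M) Φ (u ++ c ∷ reverse w)            ∎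
    where
      Φʷ : Flag M
      Φʷ = walk (adj M) Φ w

  module _ {k} {orb : Flag M → Fin k} (isOrbitMap : IsOrbitMap M orb) where

    same-orbit⇒aut : ∀ Ψ Ψ′ → orb Ψ ≡ orb Ψ′ → Σ (Aut M) λ σ → fun σ Ψ ≡ Ψ′
    same-orbit⇒aut Ψ Ψ′ = Equivalence.to (proj₂ isOrbitMap Ψ Ψ′)

    aut⇒same-orbit : ∀ (σ : Aut M) Ψ → orb Ψ ≡ orb (fun σ Ψ)
    aut⇒same-orbit σ Ψ = Equivalence.from (proj₂ isOrbitMap Ψ (fun σ Ψ)) (σ , refl)

    orb-adj-cong : ∀ c {Ψ Ψ′} → orb Ψ ≡ orb Ψ′ → orb (adj M c Ψ) ≡ orb (adj M c Ψ′)
    orb-adj-cong c {Ψ} {Ψ′} same with same-orbit⇒aut Ψ Ψ′ same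
    ... | σ , refl = trans (aut⇒same-orbit σ (adj M c Ψ)) (cong orb (hom σ c Ψ))

    orb-walk-prefix : ∀ {k′} (a : Fin k′ → Fin n) (u : Fin (suc k′) → Fin k) →
      (∀ m Ψ → orb Ψ ≡ u (inject₁ m) → orb (adj M (a m) Ψ) ≡ u (suc m)) →
      ∀ Ψ → orb Ψ ≡ u zero → ∀ i → orb (walk (adj M) Ψ (prefix a i)) ≡ u i
    orb-walk-prefix a u steps Ψ Ψ∈u₀ zero = Ψ∈u₀
    orb-walk-prefix {suc k′} a u steps Ψ Ψ∈u₀ (suc i) =
      orb-walk-prefix (a ∘ suc) (u ∘ suc) (steps ∘ suc) (adj M (a zero) Ψ) (steps zero Ψ Ψ∈u₀) i

module Generation {n k} (M : Maniplex n) (orb : Flag M → Fin (suc k))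
  (isOrbitMap : IsOrbitMap M orb) (v : Fin (suc k) → Fin (suc k))
  (v-injective : Injective _≡_ _≡_ v) (v-surjective : Surjective _≡_ _≡_ v)
  (a : Fin k → Fin n)
  (pathEdges : ∀ m → TEdge M orb (a m) (v (inject₁ m)) (v (suc m)))
  (Φ : Flag M) (Φ∈v₀ : orb Φ ≡ v zero) where

  P : Fin (suc k) → Flag M
  P i = walk (adj M) Φ (prefix a i)

  P∈v : ∀ i → orb (P i) ≡ v i
  P∈v = orb-walk-prefix M isOrbitMap a v path-step Φ Φ∈v₀
    where
      path-step : ∀ m Ψ → orb Ψ ≡ v (inject₁ m) → orb (adj M (a m) Ψ) ≡ v (suc m)
      path-step m Ψ Ψ∈vm with pathEdges m
      ... | _ , Ψ₀ , Ψ₀∈vm , Ψ₀ᵃ∈vm+1 =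
        trans (orb-adj-cong M isOrbitMap (a m) (trans Ψ∈vm (sym Ψ₀∈vm))) Ψ₀ᵃ∈vm+1

  Joins : Fin (suc k) → Fin (suc k) → Fin n → Set
  Joins i j c = Σ (Flag M) λ Ψ → orb Ψ ≡ v i × orb (adj M c Ψ) ≡ v j

  Joins-sym : ∀ {i j c} → Joins i j c → Joins j i c
  Joins-sym {c = c} (Ψ , Ψ∈vi , Ψᶜ∈vj) = adj M c Ψ , Ψᶜ∈vj , trans (cong orb (adj-invol M c Ψ)) Ψ∈vi

  Pᶜ∈v : ∀ {i j c} → Joins i j c → orb (adj M c (P i)) ≡ v j
  Pᶜ∈v {i} {c = c} (Ψ , Ψ∈vi , Ψᶜ∈vj) =
    trans (orb-adj-cong M isOrbitMap c (trans (P∈v i) (sym Ψ∈vi))) Ψᶜ∈vj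

  connecting-aut : ∀ {i j c} → Joins i j c → Σ (Aut M) λ ρ → fun ρ (P j) ≡ adj M c (P i)
  connecting-aut {i} {j} {c} joins =
    same-orbit⇒aut M isOrbitMap (P j) (adj M c (P i)) (trans (P∈v j) (sym (Pᶜ∈v joins)))

  semiEdge-generator : ∀ i s → TSemi M orb s (v i) →
    Σ (Aut M) λ σ → fun σ Φ ≡ walk (adj M) Φ (prefix a i ++ s ∷ reverse (prefix a i))
  semiEdge-generator i s semi with connecting-aut semi
  ... | ρ , ρP≡Pˢ = ρ , fun≡walk-word M ρ Φ (prefix a i) s (prefix a i) ρP≡Pˢ

  edge-generator : ∀ i j b → i <ᶠ j → TEdge M orb b (v i) (v j) → ¬ PathEdge a i j b →
    Σ (Aut M) λ σ → fun σ Φ ≡ walk (adj M) Φ (prefix a i ++ b ∷ reverse (prefix a j))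
  edge-generator i j b _ (_ , joins) _ with connecting-aut joins
  ... | ρ , ρP≡Pᵇ = ρ , fun≡walk-word M ρ Φ (prefix a i) b (prefix a j) ρP≡Pᵇ

  Generated : Aut M → Set
  Generated = ⟨ GenSet M orb v a Φ ⟩

  connecting-forward-generated : ∀ {i j c} (ρ : Aut M) → i <ᶠ j → Joins i j c →
                                 fun ρ (P j) ≡ adj M c (P i) → Generated ρ
  connecting-forward-generated {i} {j} {c} ρ i<j joins ρP≡Pᶜ with PathEdge? a i j c
  ... | no notPath = gen (inj₂ (i , j , c , i<j , (v-distinct , joins) , notPath ,
                                fun≡walk-word M ρ Φ (prefix a i) c (prefix a j) ρP≡Pᶜ))
    where
      v-distinct : ¬ v i ≡ v j
      v-distinct vi≡vj = <⇒≢ i<j (v-injective vi≡vj)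
  ... | yes (m , refl , refl , refl) = fixes-flag⇒generated M ρ (P (suc m)) ρ-fixes
    where
      ρ-fixes : fun ρ (P (suc m)) ≡ P (suc m)
      ρ-fixes = trans ρP≡Pᶜ (sym (trans (cong (walk (adj M) Φ) (prefix-suc a m))
                                        (walk-++ (adj M) Φ (prefix a (inject₁ m)) [ a m ])))

  connecting-generated : ∀ {i j c} (ρ : Aut M) → Joins i j c →
                         fun ρ (P j) ≡ adj M c (P i) → Generated ρ
  connecting-generated {i} {j} {c} ρ joins ρP≡Pᶜ with <-cmp i j
  ... | tri< i<j _ _ = connecting-forward-generated ρ i<j joins ρP≡Pᶜ
  ... | tri≈ _ refl _ = gen (inj₁ (i , c , joins , fun≡walk-word M ρ Φ (prefix a i) c (prefix a i) ρP≡Pᶜ))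
  ... | tri> _ _ j<i = ext (λ _ → refl) (invs (connecting-forward-generated (ρ ⁻¹ᴬ) j<i
                                               (Joins-sym joins) (inv-connecting M ρ c ρP≡Pᶜ)))

  RepresentativesGenerated : Flag M → Set
  RepresentativesGenerated Ψ = ∀ i (τ : Aut M) → fun τ (P i) ≡ Ψ → Generated τ

  base-representatives-generated : RepresentativesGenerated Φ
  base-representatives-generated i τ τPi≡Φ
    with v-injective (trans (trans (sym (P∈v i)) (aut⇒same-orbit M isOrbitMap τ (P i)))
                            (trans (cong orb τPi≡Φ) Φ∈v₀))
  ... | refl = fixes-flag⇒generated M τ Φ τPi≡Φ

  adj-representatives-generated : ∀ c Ψ → RepresentativesGenerated Ψ →
                                  RepresentativesGenerated (adj M c Ψ)
  adj-representatives-generated c Ψ Ψ-generated j τ′ τ′Pj≡Ψᶜ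
    with v-surjective (orb Ψ)
  ... | i , vi≡orbΨ with same-orbit⇒aut M isOrbitMap (P i) Ψ (trans (P∈v i) (vi≡orbΨ refl))
  ... | τ , τPi≡Ψ = ext (λ Ψ′ → fun-inv τ (fun τ′ Ψ′)) (mul (Ψ-generated i τ τPi≡Ψ) ρ-generated)
    where
      ρ-generated : Generated ((τ ⁻¹ᴬ) ∘ᴬ τ′)
      ρ-generated = connecting-generated ((τ ⁻¹ᴬ) ∘ᴬ τ′)
        (Ψ , sym (vi≡orbΨ refl) , trans (cong orb (sym τ′Pj≡Ψᶜ))
                                        (trans (sym (aut⇒same-orbit M isOrbitMap τ′ (P j))) (P∈v j)))
        (trans (cong (inv τ) τ′Pj≡Ψᶜ) (inv-adj M τ c τPi≡Ψ))

  walk-representatives-generated : ∀ w Ψ → RepresentativesGenerated Ψ →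
                                   RepresentativesGenerated (walk (adj M) Ψ w)
  walk-representatives-generated []      Ψ Ψ-generated = Ψ-generated
  walk-representatives-generated (c ∷ w) Ψ Ψ-generated =
    walk-representatives-generated w (adj M c Ψ) (adj-representatives-generated c Ψ Ψ-generated)

  all-generated : ∀ σ → Generated σ
  all-generated σ with connected M Φ (fun σ Φ)
  ... | w , Φʷ≡σΦ =
    walk-representatives-generated w Φ base-representatives-generated zero σ (sym Φʷ≡σΦ)

theorem5p2 : ∀ {n k} (M : Maniplex n) (orb : Flag M → Fin (suc k)) →
    IsOrbitMap M orb →
    (v : Fin (suc k) → Fin (suc k)) →
    Injective _≡_ _≡_ v → Surjective _≡_ _≡_ v →
    (a : Fin k → Fin n) →
    (∀ m → TEdge M orb (a m) (v (inject₁ m)) (v (suc m))) →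
    (Φ : Flag M) → orb Φ ≡ v zero →
    ((∀ i s → TSemi M orb s (v i) →
        Σ (Aut M) λ σ → fun σ Φ ≡ walk (adj M) Φ (prefix a i ++ s ∷ reverse (prefix a i)))
     × (∀ i j b → i <ᶠ j → TEdge M orb b (v i) (v j) → ¬ PathEdge a i j b →
        Σ (Aut M) λ σ → fun σ Φ ≡ walk (adj M) Φ (prefix a i ++ b ∷ reverse (prefix a j)))
     × (∀ σ → ⟨ GenSet M orb v a Φ ⟩ σ))
theorem5p2 M orb isOrbitMap v v-inj v-surj a pathEdges Φ Φ∈v₀ =
  semiEdge-generator , edge-generator , all-generated
  where open Generation M orb isOrbitMap v v-inj v-surj a pathEdges Φ Φ∈v₀
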